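{- Let $P=(\{\mathit{black},\mathit{white}\},A^\oplus,A^\ominus)$ be a pattern graph such that $(\{\mathit{black},\mathit{white}\},A^\oplus)$ or $(\{\mathit{black},\mathit{white}\},A^\ominus)$ contains a cycle (self-loops count as cycles). Then $\mathrm{SATURATION}(P)\in\mathsf{FO}$.
   Context: A basic graph $B=(V,E)$ is a finite undirected graph without self-loops. A pattern graph $P=(C,A^\oplus,A^\ominus)$ consists of a finite set $C$ of colors and sets $A^\oplus,A^\ominus\subseteq C\times C$. A coloring of $B$ is $c:V\to C$; a witness function for $c$ is $w:V\to V$ with, for all $x$: $x\neq w(x)$; if $\{x,w(x)\}\in E$ then $(c(x),c(w(x)))\in A^\oplus$; if $\{x,w(x)\}\notin E$ then $(c(x),c(w(x)))\in A^\ominus$. $\mathrm{SATURATION}(P)$ is the set of basic graphs admitting a coloring with a witness function. $\mathsf{FO}$ is the class of sets of graphs definable in first-order logic with the BIT predicate (logarithmic-time-uniform $\mathsf{AC}^0$). -}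

module Defs where

open import Data.Nat using (ℕ; zero; suc; _/_; _%_)
open import Data.Nat.Properties using ()
open import Data.Fin using (Fin; zero; suc; toℕ; fromℕ; inject₁)
open import Data.Bool using (Bool; true; false; not)
open import Data.Product using (Σ; _×_; _,_)
open import Data.Empty using (⊥)
open import Relation.Binary.PropositionalEquality using (_≡_)
open import Relation.Nullary using (¬_)
open import Function.Bundles using (_⇔_)

record BasicGraph : Set where
  field
    size : ℕ
    adj  : Fin size → Fin size → Bool
    sym  : ∀ x y → adj x y ≡ adj y x
    irr  : ∀ x → adj x x ≡ false
open BasicGraph public

data Color : Set where
  black white : Color

record PatternGraph : Set where
  field
    A⊕ : Color → Color → Bool
    A⊖ : Color → Color → Bool
open PatternGraph public

IsWitness : (P : PatternGraph) (B : BasicGraph) →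
            (Fin (size B) → Color) → (Fin (size B) → Fin (size B)) → Set
IsWitness P B c w =
  ∀ x → (¬ (x ≡ w x))
      × (adj B x (w x) ≡ true  → A⊕ P (c x) (c (w x)) ≡ true)
      × (adj B x (w x) ≡ false → A⊖ P (c x) (c (w x)) ≡ true)

InSaturation : PatternGraph → BasicGraph → Set
InSaturation P B =
  Σ (Fin (size B) → Color) λ c → Σ (Fin (size B) → Fin (size B)) λ w → IsWitness P B c w

-- Directed cycles in a directed graph (C, A) (self-loops count as cycles):
-- a closed walk v₀ → v₁ → … → vₖ → v₀ of length k+1 ≥ 1 along edges of A.
-- (A directed graph has a cycle iff it has a closed walk of positive length.)

next : ∀ {k} → Fin (suc k) → Fin (suc k)
next {zero}  zero    = zero
next {suc m} zero    = suc zero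
next {suc m} (suc j) with next {m} j
... | zero  = zero
... | suc r = suc (suc r)

HasCycle : (Color → Color → Bool) → Set
HasCycle A = Σ ℕ λ k → Σ (Fin (suc k) → Color) λ v →
  ∀ (i : Fin (suc k)) → A (v i) (v (next i)) ≡ true

-- Variables are de Bruijn indices: Formula k has k free variables.

data Formula : ℕ → Set where
  E⟨_,_⟩   : ∀ {k} → Fin k → Fin k → Formula k
  _≐_      : ∀ {k} → Fin k → Fin k → Formula k
  _≺_      : ∀ {k} → Fin k → Fin k → Formula k
  BIT⟨_,_⟩ : ∀ {k} → Fin k → Fin k → Formula k
  ¬ᶠ_      : ∀ {k} → Formula k → Formula k
  _∧ᶠ_     : ∀ {k} → Formula k → Formula k → Formula k
  _∨ᶠ_     : ∀ {k} → Formula k → Formula k → Formula k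
  ∀ᶠ_      : ∀ {k} → Formula (suc k) → Formula k
  ∃ᶠ_      : ∀ {k} → Formula (suc k) → Formula k

bitOf : ℕ → ℕ → Bool
bitOf m zero    = not (m % 2 Data.Nat.≡ᵇ 0)
bitOf m (suc j) = bitOf (m / 2) j

extend : ∀ {n k} → Fin n → (Fin k → Fin n) → Fin (suc k) → Fin n
extend a ρ zero    = a
extend a ρ (suc i) = ρ i

_⊨_[_] : ∀ {k} (B : BasicGraph) → Formula k → (Fin k → Fin (size B)) → Set
B ⊨ E⟨ i , j ⟩   [ ρ ] = adj B (ρ i) (ρ j) ≡ true
B ⊨ (i ≐ j)      [ ρ ] = ρ i ≡ ρ j
B ⊨ (i ≺ j)      [ ρ ] = toℕ (ρ i) Data.Nat.< toℕ (ρ j)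
B ⊨ BIT⟨ i , j ⟩ [ ρ ] = bitOf (toℕ (ρ i)) (toℕ (ρ j)) ≡ true
B ⊨ (¬ᶠ φ)       [ ρ ] = ¬ (B ⊨ φ [ ρ ])
B ⊨ (φ ∧ᶠ ψ)     [ ρ ] = (B ⊨ φ [ ρ ]) × (B ⊨ ψ [ ρ ])
B ⊨ (φ ∨ᶠ ψ)     [ ρ ] = (B ⊨ φ [ ρ ]) Data.Sum.⊎ (B ⊨ ψ [ ρ ])
  where import Data.Sum
B ⊨ (∀ᶠ φ)       [ ρ ] = ∀ a → B ⊨ φ [ extend a ρ ]
B ⊨ (∃ᶠ φ)       [ ρ ] = Σ (Fin (size B)) λ a → B ⊨ φ [ extend a ρ ]

emptyEnv : ∀ {n} → Fin 0 → Fin n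
emptyEnv ()

_⊨_ : BasicGraph → Formula 0 → Set
B ⊨ φ = B ⊨ φ [ emptyEnv ]

InFO : (BasicGraph → Set) → Set
InFO S = Σ (Formula 0) λ φ → ∀ (B : BasicGraph) → (B ⊨ φ) ⇔ S B

-- Suppose A⊕ has a cycle; the case of A⊖ reduces to it by complementing the graph and swapping
-- A⊕ with A⊖.  Without isolated vertices, a loop of A⊕ at a is realised by the constant colouring a,
-- and a 2-cycle by a colouring in which every non-isolated vertex has a neighbour of the opposite
-- colour.  If z is isolated and A⊖ is cyclic, the complement has no isolated vertex.  If z is
-- isolated and A⊖ is acyclic, the colour e of z and its witness force A⊖ e ē, and then A⊕ has a
-- 2-cycle, or A⊕ ē ē (colour exactly the non-isolated vertices ē), or only the loop A⊕ e e, in which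
-- case colouring one or two vertices ē and all others e works; they are found through pendant
-- vertices.  The colourings of the last two cases are first-order definable from two parameters,
-- so every case is detected by a first-order sentence.
module Submission where

open import Defs renaming (sym to adj-sym)
open import Data.Bool using (Bool; true; false; not)
open import Data.Bool.Properties using (¬-not; not-injective) renaming (_≟_ to _≟ᵇ_)
open import Data.Fin using (Fin; zero; suc; toℕ)
open import Data.Fin.Properties using (any?; all?; ¬∀⟶∃¬) renaming (_≟_ to _≟ᶠ_)
open import Data.Nat using (zero; suc; _<_)
open import Data.Nat.Properties using (_<?_)
open import Data.Product using (Σ; _×_; _,_; proj₁; proj₂)
open import Data.Product.Function.NonDependent.Propositional using (_×-⇔_)
open import Data.Sum using (_⊎_; inj₁; inj₂; [_,_]; reduce) renaming (map to ⊎-map)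
open import Data.Sum.Function.Propositional using (_⊎-⇔_)
open import Function.Bundles using (_⇔_; mk⇔; Equivalence)
open import Function.Construct.Identity using (⇔-id)
open import Function.Properties.Equivalence using () renaming (trans to ⇔-trans)
open import Function.Related.TypeIsomorphisms using (¬-cong-⇔)
open import Relation.Binary.PropositionalEquality using (_≡_; _≢_; refl; sym; trans; cong; subst)
open import Relation.Nullary using (¬_; Dec; yes; no; does; contradiction)
open import Relation.Nullary.Decidable using (_×-dec_; _⊎-dec_; _→-dec_; ¬?; dec-true; dec-false; does-⇔)

open Equivalence using (to; from)

flip : Color → Color
flip black = white
flip white = black

flip-≢ : ∀ a → a ≢ flip a
flip-≢ black ()
flip-≢ white ()

≡⊎≡flip : ∀ a b → b ≡ a ⊎ b ≡ flip a
≡⊎≡flip black black = inj₁ refl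
≡⊎≡flip black white = inj₂ refl
≡⊎≡flip white black = inj₂ refl
≡⊎≡flip white white = inj₁ refl

≢⇒≡flip : ∀ {a b} → a ≢ b → b ≡ flip a
≢⇒≡flip {a} {b} a≢b with ≡⊎≡flip a b
... | inj₁ b≡a = contradiction (sym b≡a) a≢b
... | inj₂ b≡ā = b≡ā

∃ᶜ? : {Q : Color → Set} → (∀ a → Dec (Q a)) → Dec (Σ Color Q)
∃ᶜ? Q? with Q? black | Q? white
... | yes q | _     = yes (black , q)
... | no _  | yes q = yes (white , q)
... | no ¬b | no ¬w = no λ { (black , q) → ¬b q ; (white , q) → ¬w q }

TwoCycle : (Color → Color → Bool) → Set
TwoCycle A = A black white ≡ true × A white black ≡ true

Cyclic : (Color → Color → Bool) → Set
Cyclic A = Σ Color (λ a → A a a ≡ true) ⊎ TwoCycle A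

twoCycle? : ∀ A → Dec (TwoCycle A)
twoCycle? A = (A black white ≟ᵇ true) ×-dec (A white black ≟ᵇ true)

cyclic? : ∀ A → Dec (Cyclic A)
cyclic? A = ∃ᶜ? (λ a → A a a ≟ᵇ true) ⊎-dec twoCycle? A

twoCycle-intro : ∀ A a → A a (flip a) ≡ true → A (flip a) a ≡ true → TwoCycle A
twoCycle-intro A black p q = p , q
twoCycle-intro A white p q = q , p

twoCycle-flip : ∀ A → TwoCycle A → ∀ a → A a (flip a) ≡ true
twoCycle-flip A (p , q) black = p
twoCycle-flip A (p , q) white = q

path⇒cyclic : ∀ A {a b c} → A a b ≡ true → A b c ≡ true → Cyclic A
path⇒cyclic A {black} {black}         p q = inj₁ (black , p)
path⇒cyclic A {white} {white}         p q = inj₁ (white , p)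
path⇒cyclic A {black} {white} {white} p q = inj₁ (white , q)
path⇒cyclic A {white} {black} {black} p q = inj₁ (black , q)
path⇒cyclic A {black} {white} {black} p q = inj₂ (p , q)
path⇒cyclic A {white} {black} {white} p q = inj₂ (q , p)

-- With two colours, the first two steps of a closed walk already close a cycle.
hasCycle⇒cyclic : ∀ A → HasCycle A → Cyclic A
hasCycle⇒cyclic A (_ , v , step) = path⇒cyclic A (step zero) (step (next zero))

loop-at-other : ∀ A e → Cyclic A → ¬ TwoCycle A → A (flip e) (flip e) ≡ false → A e e ≡ true
loop-at-other A e (inj₂ t) ¬t _ = contradiction t ¬t
loop-at-other A e (inj₁ (a , aa)) _ ēē with ≡⊎≡flip e a
... | inj₁ refl = aa
... | inj₂ refl = contradiction (trans (sym aa) ēē) λ ()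

allowed : PatternGraph → Bool → Color → Color → Bool
allowed P true  = A⊕ P
allowed P false = A⊖ P

allowed-≡ : ∀ P {s s′ a a′ b b′} → s ≡ s′ → a ≡ a′ → b ≡ b′ →
            (allowed P s a b ≡ true) ⇔ (allowed P s′ a′ b′ ≡ true)
allowed-≡ P refl refl refl = ⇔-id _

allowed⇔ : ∀ P s a b → (allowed P s a b ≡ true) ⇔
           ((s ≡ true → A⊕ P a b ≡ true) × (s ≡ false → A⊖ P a b ≡ true))
allowed⇔ P true  a b = mk⇔ (λ p → (λ _ → p) , λ ()) (λ (p , _) → p refl)
allowed⇔ P false a b = mk⇔ (λ p → (λ ()) , λ _ → p) (λ (_ , p) → p refl)

swap : PatternGraph → PatternGraph
swap P = record { A⊕ = A⊖ P ; A⊖ = A⊕ P }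

allowed-swap : ∀ P s → allowed (swap P) (not s) ≡ allowed P s
allowed-swap P true  = refl
allowed-swap P false = refl

Vertex : BasicGraph → Set
Vertex B = Fin (size B)

Colouring : BasicGraph → Set
Colouring B = Vertex B → Color

NonIsolated : (B : BasicGraph) → Vertex B → Set
NonIsolated B x = Σ (Vertex B) λ y → adj B x y ≡ true

Isolated : (B : BasicGraph) → Vertex B → Set
Isolated B x = ∀ y → adj B x y ≡ false

Universal : (B : BasicGraph) → Vertex B → Set
Universal B x = ∀ y → x ≢ y → adj B x y ≡ true

NoIsolatedVertex : BasicGraph → Set
NoIsolatedVertex B = ∀ x → NonIsolated B x

HasEdge : BasicGraph → Set
HasEdge B = Σ (Vertex B) (NonIsolated B)

neighbour? : ∀ {n} (a : Fin n → Fin n → Bool) x → Dec (Σ (Fin n) λ y → a x y ≡ true)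
neighbour? a x = any? λ y → a x y ≟ᵇ true

edge-sym : ∀ B {x y} → adj B x y ≡ true → adj B y x ≡ true
edge-sym B {x} {y} xy = trans (adj-sym B y x) xy

edge⇒≢ : ∀ B {x y} → adj B x y ≡ true → x ≢ y
edge⇒≢ B {x} xy refl = contradiction (trans (sym xy) (irr B x)) λ ()

noIsolatedVertex⊎isolated : ∀ B → NoIsolatedVertex B ⊎ Σ (Vertex B) (Isolated B)
noIsolatedVertex⊎isolated B with all? (neighbour? (adj B))
... | yes noIso = inj₁ noIso
... | no ¬noIso =
  let (z , ¬nz) = ¬∀⟶∃¬ _ (NonIsolated B) (neighbour? (adj B)) ¬noIso
  in  inj₂ (z , λ y → ¬-not λ zy → ¬nz (y , zy))

universal⇒noIsolatedVertex : ∀ B {z} → Universal B z → Σ (Vertex B) (z ≢_) → NoIsolatedVertex B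
universal⇒noIsolatedVertex B {z} univ (y , z≢y) x with z ≟ᶠ x
... | yes refl = y , univ y z≢y
... | no z≢x   = z , edge-sym B (univ x z≢x)

CertifiedAt : ∀ P B → Colouring B → Vertex B → Set
CertifiedAt P B c x = Σ (Vertex B) λ y → x ≢ y × allowed P (adj B x y) (c x) (c y) ≡ true

Certificate : PatternGraph → (B : BasicGraph) → Colouring B → Set
Certificate P B c = ∀ x → CertifiedAt P B c x

certificate⇒saturated : ∀ P B c → Certificate P B c → InSaturation P B
certificate⇒saturated P B c cert = c , (λ x → proj₁ (cert x)) , λ x →
  let (y , x≢y , ok) = cert x in x≢y , to (allowed⇔ P (adj B x y) (c x) (c y)) ok

saturated⇒certificate : ∀ P B (sat : InSaturation P B) → Certificate P B (proj₁ sat)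
saturated⇒certificate P B (c , w , wit) x =
  let (x≢wx , ok) = wit x in w x , x≢wx , from (allowed⇔ P (adj B x (w x)) (c x) (c (w x))) ok

saturated⇒other : ∀ P B → InSaturation P B → ∀ z → Σ (Vertex B) (z ≢_)
saturated⇒other P B (c , w , wit) z = w z , proj₁ (wit z)

complement : BasicGraph → BasicGraph
complement B = record { size = size B ; adj = adjᶜ ; sym = adjᶜ-sym ; irr = adjᶜ-irr }
  where
  adjᶜ : Vertex B → Vertex B → Bool
  adjᶜ x y with x ≟ᶠ y
  ... | yes _ = false
  ... | no _  = not (adj B x y)

  adjᶜ-sym : ∀ x y → adjᶜ x y ≡ adjᶜ y x
  adjᶜ-sym x y with x ≟ᶠ y | y ≟ᶠ x
  ... | yes _   | yes _   = refl
  ... | yes x≡y | no y≢x  = contradiction (sym x≡y) y≢x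
  ... | no x≢y  | yes y≡x = contradiction (sym y≡x) x≢y
  ... | no _    | no _    = cong not (adj-sym B x y)

  adjᶜ-irr : ∀ x → adjᶜ x x ≡ false
  adjᶜ-irr x with x ≟ᶠ x
  ... | yes _  = refl
  ... | no x≢x = contradiction refl x≢x

complement-adj : ∀ B {x y} → x ≢ y → adj (complement B) x y ≡ not (adj B x y)
complement-adj B {x} {y} x≢y with x ≟ᶠ y
... | yes x≡y = contradiction x≡y x≢y
... | no _    = refl

complement-edge⇔ : ∀ B x y → (x ≢ y × ¬ adj B x y ≡ true) ⇔ (adj (complement B) x y ≡ true)
complement-edge⇔ B x y = mk⇔
  (λ (x≢y , ¬xy) → trans (complement-adj B x≢y) (cong not (¬-not ¬xy)))
  (λ xy → let x≢y = edge⇒≢ (complement B) xy in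
          x≢y , λ xy′ → contradiction (trans (sym xy) (trans (complement-adj B x≢y) (cong not xy′)))
                                      λ ())

isolated⇒universal-complement : ∀ B {z} → Isolated B z → Universal (complement B) z
isolated⇒universal-complement B iso y z≢y = trans (complement-adj B z≢y) (cong not (iso y))

isolated-complement⇒universal : ∀ B {z} → Isolated (complement B) z → Universal B z
isolated-complement⇒universal B {z} iso y z≢y =
  not-injective {adj B z y} {true} (trans (sym (complement-adj B z≢y)) (iso y))

allowed-complement : ∀ P B {x y} → x ≢ y →
                     allowed (swap P) (adj (complement B) x y) ≡ allowed P (adj B x y)
allowed-complement P B {x} {y} x≢y =
  trans (cong (allowed (swap P)) (complement-adj B x≢y)) (allowed-swap P (adj B x y))

saturated-complement : ∀ P B → InSaturation P B → InSaturation (swap P) (complement B)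
saturated-complement P B sat@(c , _) = certificate⇒saturated (swap P) (complement B) c λ x →
  let (y , x≢y , ok) = saturated⇒certificate P B sat x
  in  y , x≢y , trans (cong (λ A → A (c x) (c y)) (allowed-complement P B x≢y)) ok

saturated-uncomplement : ∀ P B → InSaturation (swap P) (complement B) → InSaturation P B
saturated-uncomplement P B sat@(c , _) = certificate⇒saturated P B c λ x →
  let (y , x≢y , ok) = saturated⇒certificate (swap P) (complement B) sat x
  in  y , x≢y , trans (cong (λ A → A (c x) (c y)) (sym (allowed-complement P B x≢y))) ok

OppositeNeighbours : ∀ {n} → (Fin n → Fin n → Bool) → Set
OppositeNeighbours {n} a = Σ (Fin n → Color) λ c → Σ (Fin n → Fin n) λ w →
  ∀ x → Σ (Fin n) (λ y → a x y ≡ true) → a x (w x) ≡ true × c x ≢ c (w x)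

-- Induction on the vertices: a new vertex 0 with a neighbour u takes the colour opposite to u,
-- and vertices whose only neighbour is 0 take the colour of u.
opposite-neighbours : ∀ n (a : Fin n → Fin n → Bool) →
                      (∀ x y → a x y ≡ a y x) → (∀ x → a x x ≡ false) → OppositeNeighbours a
opposite-neighbours zero a a-sym a-irr = (λ ()) , (λ ()) , λ ()
opposite-neighbours (suc n) a a-sym a-irr = extend-by-0 (neighbour? a zero)
  where
  a′ : Fin n → Fin n → Bool
  a′ x y = a (suc x) (suc y)

  IH = opposite-neighbours n a′ (λ x y → a-sym (suc x) (suc y)) (λ x → a-irr (suc x))
  c′ = proj₁ IH
  w′ = proj₁ (proj₂ IH)
  opposite′ = proj₂ (proj₂ IH)

  only-neighbour-0 : ∀ x → ¬ Σ (Fin n) (λ y → a′ x y ≡ true) →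
                     ∀ y → a (suc x) y ≡ true → a (suc x) zero ≡ true
  only-neighbour-0 x iso′ zero    p = p
  only-neighbour-0 x iso′ (suc y) p = contradiction (y , p) iso′

  extend-by-0 : Dec (Σ (Fin (suc n)) λ y → a zero y ≡ true) → OppositeNeighbours a
  extend-by-0 (no 0-isolated) = c , w , opposite
    where
    c : Fin (suc n) → Color
    c zero    = black
    c (suc x) = c′ x
    w : Fin (suc n) → Fin (suc n)
    w zero    = zero
    w (suc x) = suc (w′ x)
    opposite : ∀ x → Σ _ (λ y → a x y ≡ true) → a x (w x) ≡ true × c x ≢ c (w x)
    opposite zero    0y           = contradiction 0y 0-isolated
    opposite (suc x) (zero , x0)  = contradiction (suc x , trans (a-sym zero (suc x)) x0) 0-isolated
    opposite (suc x) (suc y , xy) = opposite′ x (y , xy)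
  extend-by-0 (yes (zero , loop)) = contradiction (trans (sym loop) (a-irr zero)) λ ()
  extend-by-0 (yes (suc u , 0u)) = c , w , opposite
    where
    c : Fin (suc n) → Color
    c zero = flip (c′ u)
    c (suc x) with neighbour? a′ x
    ... | yes _ = c′ x
    ... | no _  = c′ u
    w : Fin (suc n) → Fin (suc n)
    w zero = suc u
    w (suc x) with neighbour? a′ x
    ... | yes _ = suc (w′ x)
    ... | no _  = zero
    c-u : c (suc u) ≡ c′ u
    c-u with neighbour? a′ u
    ... | yes _ = refl
    ... | no _  = refl
    opposite : ∀ x → Σ _ (λ y → a x y ≡ true) → a x (w x) ≡ true × c x ≢ c (w x)
    opposite zero _ = 0u , λ eq → flip-≢ (c′ u) (sym (trans eq c-u))
    opposite (suc x) (y , xy) with neighbour? a′ x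
    ... | no iso′ = only-neighbour-0 x iso′ y xy , flip-≢ (c′ u)
    ... | yes nb′ with opposite′ x nb′
    ...   | xw′ , c′≢ with neighbour? a′ (w′ x)
    ...     | yes _    = xw′ , c′≢
    ...     | no iso′w = contradiction (x , trans (a-sym (suc (w′ x)) (suc x)) xw′) iso′w

module OppositeColouring (B : BasicGraph) where
  private
    choice = opposite-neighbours (size B) (adj B) (adj-sym B) (irr B)

  c : Colouring B
  c = proj₁ choice

  w : Vertex B → Vertex B
  w = proj₁ (proj₂ choice)

  opposite : ∀ x → NonIsolated B x → adj B x (w x) ≡ true × c x ≢ c (w x)
  opposite = proj₂ (proj₂ choice)

  w-nonIsolated : ∀ x → NonIsolated B x → NonIsolated B (w x)
  w-nonIsolated x nb = x , edge-sym B (proj₁ (opposite x nb))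

cyclic⇒noIsolated⇒saturated : ∀ P B → Cyclic (A⊕ P) → NoIsolatedVertex B → InSaturation P B
cyclic⇒noIsolated⇒saturated P B (inj₁ (a , aa)) noIso = certificate⇒saturated P B (λ _ → a) λ x →
  let (y , xy) = noIso x in y , edge⇒≢ B xy , from (allowed-≡ P xy refl refl) aa
cyclic⇒noIsolated⇒saturated P B (inj₂ twoCycle) noIso = certificate⇒saturated P B c λ x →
  let (xwx , c≢) = opposite x (noIso x)
  in  w x , edge⇒≢ B xwx ,
      from (allowed-≡ P xwx refl (≢⇒≡flip c≢)) (twoCycle-flip (A⊕ P) twoCycle (c x))
  where open OppositeColouring B

-- Non-isolated vertices keep the opposite colouring; isolated ones take colour d and point to a
-- non-isolated vertex t of colour d′.
twoCycle⇒edge⇒saturated : ∀ P B {d d′} → TwoCycle (A⊕ P) → A⊖ P d d′ ≡ true → HasEdge B →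
                          InSaturation P B
twoCycle⇒edge⇒saturated P B {d} {d′} twoCycle dd′ (p , p-nonIso) =
  certificate⇒saturated P B c″ certificate
  where
  open OppositeColouring B

  target : Σ (Vertex B) λ t → NonIsolated B t × c t ≡ d′
  target with ≡⊎≡flip (c p) d′
  ... | inj₁ d′≡cp = p , p-nonIso , sym d′≡cp
  ... | inj₂ d′≡c̄p = w p , w-nonIsolated p p-nonIso ,
                     trans (≢⇒≡flip (proj₂ (opposite p p-nonIso))) (sym d′≡c̄p)
  t = proj₁ target
  t-nonIso = proj₁ (proj₂ target)

  c″ : Colouring B
  c″ x with neighbour? (adj B) x
  ... | yes _ = c x
  ... | no _  = d

  c″-nonIsolated : ∀ x → NonIsolated B x → c″ x ≡ c x
  c″-nonIsolated x nb with neighbour? (adj B) x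
  ... | yes _ = refl
  ... | no iso = contradiction nb iso

  certificate : Certificate P B c″
  certificate x with neighbour? (adj B) x
  ... | yes nb =
    let (xwx , c≢) = opposite x nb
        cwx = trans (c″-nonIsolated (w x) (w-nonIsolated x nb)) (≢⇒≡flip c≢)
    in  w x , edge⇒≢ B xwx , from (allowed-≡ P xwx refl cwx) (twoCycle-flip (A⊕ P) twoCycle (c x))
  ... | no iso =
    let ct = trans (c″-nonIsolated t t-nonIso) (proj₂ (proj₂ target))
    in  t , (λ { refl → iso t-nonIso }) , from (allowed-≡ P (¬-not λ xt → iso (t , xt)) refl ct) dd′

Π-⇔ : {A : Set} {Q R : A → Set} → (∀ a → Q a ⇔ R a) → ((a : A) → Q a) ⇔ ((a : A) → R a)
Π-⇔ Q⇔R = mk⇔ (λ q a → to (Q⇔R a) (q a)) (λ r a → from (Q⇔R a) (r a))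

Σ-⇔ : {A : Set} {Q R : A → Set} → (∀ a → Q a ⇔ R a) → Σ A Q ⇔ Σ A R
Σ-⇔ Q⇔R = mk⇔ (λ (a , q) → a , to (Q⇔R a) q) (λ (a , r) → a , from (Q⇔R a) r)

cong₂-⇔ : {A : Set} (R : A → A → Set) {a a′ b b′ : A} → a ≡ a′ → b ≡ b′ → R a b ⇔ R a′ b′
cong₂-⇔ R refl refl = ⇔-id _

⊨? : ∀ B {k} (φ : Formula k) (ρ : Fin k → Vertex B) → Dec (B ⊨ φ [ ρ ])
⊨? B E⟨ i , j ⟩   ρ = adj B (ρ i) (ρ j) ≟ᵇ true
⊨? B (i ≐ j)      ρ = ρ i ≟ᶠ ρ j
⊨? B (i ≺ j)      ρ = toℕ (ρ i) <? toℕ (ρ j)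
⊨? B BIT⟨ i , j ⟩ ρ = bitOf (toℕ (ρ i)) (toℕ (ρ j)) ≟ᵇ true
⊨? B (¬ᶠ φ)       ρ = ¬? (⊨? B φ ρ)
⊨? B (φ ∧ᶠ ψ)     ρ = ⊨? B φ ρ ×-dec ⊨? B ψ ρ
⊨? B (φ ∨ᶠ ψ)     ρ = ⊨? B φ ρ ⊎-dec ⊨? B ψ ρ
⊨? B (∀ᶠ φ)       ρ = all? λ a → ⊨? B φ (extend a ρ)
⊨? B (∃ᶠ φ)       ρ = any? λ a → ⊨? B φ (extend a ρ)

truth : ∀ B {k} → Formula k → (Fin k → Vertex B) → Bool
truth B φ ρ = does (⊨? B φ ρ)

truth-edge : ∀ B {k} (i j : Fin k) ρ → truth B E⟨ i , j ⟩ ρ ≡ adj B (ρ i) (ρ j)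
truth-edge B i j ρ with adj B (ρ i) (ρ j)
... | true  = refl
... | false = refl

ext : ∀ {k m} → (Fin k → Fin m) → Fin (suc k) → Fin (suc m)
ext σ zero    = zero
ext σ (suc i) = suc (σ i)

extend-ext : ∀ {n k m} (σ : Fin k → Fin m) {ρ : Fin m → Fin n} {ρ′} → (∀ i → ρ (σ i) ≡ ρ′ i) →
             ∀ a i → extend a ρ (ext σ i) ≡ extend a ρ′ i
extend-ext σ ρσ≗ρ′ a zero    = refl
extend-ext σ ρσ≗ρ′ a (suc i) = ρσ≗ρ′ i

rename : ∀ {k m} → (Fin k → Fin m) → Formula k → Formula m
rename σ E⟨ i , j ⟩   = E⟨ σ i , σ j ⟩
rename σ (i ≐ j)      = σ i ≐ σ j
rename σ (i ≺ j)      = σ i ≺ σ j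
rename σ BIT⟨ i , j ⟩ = BIT⟨ σ i , σ j ⟩
rename σ (¬ᶠ φ)       = ¬ᶠ (rename σ φ)
rename σ (φ ∧ᶠ ψ)     = rename σ φ ∧ᶠ rename σ ψ
rename σ (φ ∨ᶠ ψ)     = rename σ φ ∨ᶠ rename σ ψ
rename σ (∀ᶠ φ)       = ∀ᶠ (rename (ext σ) φ)
rename σ (∃ᶠ φ)       = ∃ᶠ (rename (ext σ) φ)

⊨-rename : ∀ B {k m} (φ : Formula k) (σ : Fin k → Fin m) {ρ : Fin m → Vertex B} {ρ′} →
           (∀ i → ρ (σ i) ≡ ρ′ i) → (B ⊨ rename σ φ [ ρ ]) ⇔ (B ⊨ φ [ ρ′ ])
⊨-rename B E⟨ i , j ⟩   σ ρσ≗ρ′ = cong₂-⇔ (λ x y → adj B x y ≡ true) (ρσ≗ρ′ i) (ρσ≗ρ′ j)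
⊨-rename B (i ≐ j)      σ ρσ≗ρ′ = cong₂-⇔ _≡_ (ρσ≗ρ′ i) (ρσ≗ρ′ j)
⊨-rename B (i ≺ j)      σ ρσ≗ρ′ = cong₂-⇔ (λ x y → toℕ x < toℕ y) (ρσ≗ρ′ i) (ρσ≗ρ′ j)
⊨-rename B BIT⟨ i , j ⟩ σ ρσ≗ρ′ =
  cong₂-⇔ (λ x y → bitOf (toℕ x) (toℕ y) ≡ true) (ρσ≗ρ′ i) (ρσ≗ρ′ j)
⊨-rename B (¬ᶠ φ)   σ ρσ≗ρ′ = ¬-cong-⇔ (⊨-rename B φ σ ρσ≗ρ′)
⊨-rename B (φ ∧ᶠ ψ) σ ρσ≗ρ′ = ⊨-rename B φ σ ρσ≗ρ′ ×-⇔ ⊨-rename B ψ σ ρσ≗ρ′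
⊨-rename B (φ ∨ᶠ ψ) σ ρσ≗ρ′ = ⊨-rename B φ σ ρσ≗ρ′ ⊎-⇔ ⊨-rename B ψ σ ρσ≗ρ′
⊨-rename B (∀ᶠ φ)   σ ρσ≗ρ′ = Π-⇔ λ a → ⊨-rename B φ (ext σ) (extend-ext σ ρσ≗ρ′ a)
⊨-rename B (∃ᶠ φ)   σ ρσ≗ρ′ = Σ-⇔ λ a → ⊨-rename B φ (ext σ) (extend-ext σ ρσ≗ρ′ a)

⊥ᶠ : ∀ {k} → Formula k
⊥ᶠ = ∃ᶠ (¬ᶠ (zero ≐ zero))

constᶠ : ∀ {k} → Bool → Formula k
constᶠ true  = ¬ᶠ ⊥ᶠ
constᶠ false = ⊥ᶠ

⊨-constᶠ : ∀ B {k} b (ρ : Fin k → Vertex B) → (B ⊨ constᶠ b [ ρ ]) ⇔ (b ≡ true)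
⊨-constᶠ B true  ρ = mk⇔ (λ _ → refl) (λ _ (a , a≢a) → a≢a refl)
⊨-constᶠ B false ρ = mk⇔ (λ (a , a≢a) → contradiction refl a≢a) λ ()

caseᶠ : ∀ {k} → (Bool → Formula k) → Formula k → Formula k
caseᶠ f φ = (φ ∧ᶠ f true) ∨ᶠ ((¬ᶠ φ) ∧ᶠ f false)

⊨-caseᶠ : ∀ B {k} (f : Bool → Formula k) φ ρ → (B ⊨ caseᶠ f φ [ ρ ]) ⇔ (B ⊨ f (truth B φ ρ) [ ρ ])
⊨-caseᶠ B f φ ρ with ⊨? B φ ρ
... | yes p = mk⇔ (λ { (inj₁ (_ , q)) → q ; (inj₂ (¬p , _)) → contradiction p ¬p }) (λ q → inj₁ (p , q))
... | no ¬p = mk⇔ (λ { (inj₁ (p , _)) → contradiction p ¬p ; (inj₂ (_ , q)) → q }) (λ q → inj₂ (¬p , q))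

when : {X : Set} → Dec X → Formula 0 → Formula 0
when (yes _) φ = φ
when (no _)  φ = ⊥ᶠ

when-elim : ∀ B {X} (d : Dec X) φ → B ⊨ when d φ → X × B ⊨ φ
when-elim B (yes x) φ h         = x , h
when-elim B (no _)  φ (a , a≢a) = contradiction refl a≢a

when-intro : ∀ B {X} (d : Dec X) φ → X → B ⊨ φ → B ⊨ when d φ
when-intro B (yes _) φ _ h = h
when-intro B (no ¬x) φ x _ = contradiction x ¬x

complementᶠ : ∀ {k} → Formula k → Formula k
complementᶠ E⟨ i , j ⟩   = (¬ᶠ (i ≐ j)) ∧ᶠ (¬ᶠ E⟨ i , j ⟩)
complementᶠ (i ≐ j)      = i ≐ j
complementᶠ (i ≺ j)      = i ≺ j
complementᶠ BIT⟨ i , j ⟩ = BIT⟨ i , j ⟩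
complementᶠ (¬ᶠ φ)       = ¬ᶠ (complementᶠ φ)
complementᶠ (φ ∧ᶠ ψ)     = complementᶠ φ ∧ᶠ complementᶠ ψ
complementᶠ (φ ∨ᶠ ψ)     = complementᶠ φ ∨ᶠ complementᶠ ψ
complementᶠ (∀ᶠ φ)       = ∀ᶠ (complementᶠ φ)
complementᶠ (∃ᶠ φ)       = ∃ᶠ (complementᶠ φ)

⊨-complementᶠ : ∀ B {k} (φ : Formula k) ρ → (B ⊨ complementᶠ φ [ ρ ]) ⇔ (complement B ⊨ φ [ ρ ])
⊨-complementᶠ B E⟨ i , j ⟩   ρ = complement-edge⇔ B (ρ i) (ρ j)
⊨-complementᶠ B (i ≐ j)      ρ = ⇔-id _
⊨-complementᶠ B (i ≺ j)      ρ = ⇔-id _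
⊨-complementᶠ B BIT⟨ i , j ⟩ ρ = ⇔-id _
⊨-complementᶠ B (¬ᶠ φ)       ρ = ¬-cong-⇔ (⊨-complementᶠ B φ ρ)
⊨-complementᶠ B (φ ∧ᶠ ψ)     ρ = ⊨-complementᶠ B φ ρ ×-⇔ ⊨-complementᶠ B ψ ρ
⊨-complementᶠ B (φ ∨ᶠ ψ)     ρ = ⊨-complementᶠ B φ ρ ⊎-⇔ ⊨-complementᶠ B ψ ρ
⊨-complementᶠ B (∀ᶠ φ)       ρ = Π-⇔ λ a → ⊨-complementᶠ B φ (extend a ρ)
⊨-complementᶠ B (∃ᶠ φ)       ρ = Σ-⇔ λ a → ⊨-complementᶠ B φ (extend a ρ)

paint : Color → Bool → Color
paint c true  = flip c
paint c false = c

triple : ∀ {n} → Fin n → Fin n → Fin n → Fin 3 → Fin n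
triple v x₁ x₂ = extend v (extend x₁ (extend x₂ emptyEnv))

definedColouring : ∀ B → Formula 3 → Color → Vertex B → Vertex B → Colouring B
definedColouring B χ c x₁ x₂ v = paint c (truth B χ (triple v x₁ x₂))

colour-inside : ∀ B χ c x₁ x₂ {v} → B ⊨ χ [ triple v x₁ x₂ ] → definedColouring B χ c x₁ x₂ v ≡ flip c
colour-inside B χ c x₁ x₂ p = cong (paint c) (dec-true (⊨? B χ _) p)

colour-outside : ∀ B χ c x₁ x₂ {v} → ¬ B ⊨ χ [ triple v x₁ x₂ ] → definedColouring B χ c x₁ x₂ v ≡ c
colour-outside B χ c x₁ x₂ ¬p = cong (paint c) (dec-false (⊨? B χ _) ¬p)

-- The variables of ∃x₁ ∃x₂ ∀v ∃u, as de Bruijn indices.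
var-u var-v var-x₂ var-x₁ : Fin 4
var-u  = zero
var-v  = suc zero
var-x₂ = suc (suc zero)
var-x₁ = suc (suc (suc zero))

at : Fin 4 → Fin 3 → Fin 4
at t zero             = t
at t (suc zero)       = var-x₁
at t (suc (suc zero)) = var-x₂

at-triple : ∀ {n} (ρ : Fin 4 → Fin n) t i → ρ (at t i) ≡ triple (ρ t) (ρ var-x₁) (ρ var-x₂) i
at-triple ρ t zero             = refl
at-triple ρ t (suc zero)       = refl
at-triple ρ t (suc (suc zero)) = refl

verdictᶠ : PatternGraph → Color → Bool → Bool → Bool → Formula 4
verdictᶠ P c s bv bu = constᶠ (allowed P s (paint c bv) (paint c bu))

allowedᶠ : PatternGraph → Formula 3 → Color → Formula 4
allowedᶠ P χ c =
  caseᶠ (λ s → caseᶠ (λ bv → caseᶠ (verdictᶠ P c s bv) (rename (at var-u) χ)) (rename (at var-v) χ))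
        E⟨ var-v , var-u ⟩

template : PatternGraph → Formula 3 → Color → Formula 0
template P χ c = ∃ᶠ (∃ᶠ (∀ᶠ (∃ᶠ ((¬ᶠ (var-v ≐ var-u)) ∧ᶠ allowedᶠ P χ c))))

⊨-allowedᶠ : ∀ P B χ c (ρ : Fin 4 → Vertex B) →
  let v = ρ var-v ; u = ρ var-u ; colour = definedColouring B χ c (ρ var-x₁) (ρ var-x₂)
  in  (B ⊨ allowedᶠ P χ c [ ρ ]) ⇔ (allowed P (adj B v u) (colour v) (colour u) ≡ true)
⊨-allowedᶠ P B χ c ρ =
  ⇔-trans (⊨-caseᶠ B (λ s → caseᶠ (λ bv → caseᶠ (verdictᶠ P c s bv) χu) χv) E⟨ var-v , var-u ⟩ ρ) (
  ⇔-trans (⊨-caseᶠ B (λ bv → caseᶠ (verdictᶠ P c sᵥᵤ bv) χu) χv ρ) (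
  ⇔-trans (⊨-caseᶠ B (verdictᶠ P c sᵥᵤ (truth B χv ρ)) χu ρ) (
  ⇔-trans (⊨-constᶠ B _ ρ)
          (allowed-≡ P (truth-edge B var-v var-u ρ) (cong (paint c) (truth-at var-v))
                       (cong (paint c) (truth-at var-u))))))
  where
  χv = rename (at var-v) χ
  χu = rename (at var-u) χ
  sᵥᵤ = truth B E⟨ var-v , var-u ⟩ ρ
  truth-at : ∀ t → truth B (rename (at t) χ) ρ ≡ truth B χ (triple (ρ t) (ρ var-x₁) (ρ var-x₂))
  truth-at t = does-⇔ (⊨-rename B χ (at t) (at-triple ρ t)) (⊨? B _ ρ) (⊨? B χ _)

template-sound : ∀ P B χ c → B ⊨ template P χ c → InSaturation P B
template-sound P B χ c (x₁ , x₂ , certify) =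
  certificate⇒saturated P B (definedColouring B χ c x₁ x₂) λ v →
  let (u , v≢u , ok) = certify v in u , v≢u , to (⊨-allowedᶠ P B χ c _) ok

template-complete : ∀ P B χ c x₁ x₂ → Certificate P B (definedColouring B χ c x₁ x₂) →
                    B ⊨ template P χ c
template-complete P B χ c x₁ x₂ cert = x₁ , x₂ , λ v →
  let (u , v≢u , ok) = cert v in u , v≢u , from (⊨-allowedᶠ P B χ c _) ok

nonIsolatedᶠ : Formula 3
nonIsolatedᶠ = ∃ᶠ E⟨ suc zero , zero ⟩

pairᶠ : Formula 3
pairᶠ = (zero ≐ suc zero) ∨ᶠ (zero ≐ suc (suc zero))

InPair : ∀ {n} → Fin n → Fin n → Fin n → Set
InPair x₁ x₂ v = v ≡ x₁ ⊎ v ≡ x₂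

PairPattern : PatternGraph → Color → Set
PairPattern P e = A⊕ P (flip e) e ≡ true × A⊕ P e e ≡ true × A⊖ P e (flip e) ≡ true

pair-certificate : ∀ P B e x₁ x₂ → PairPattern P e →
  (∀ v → InPair x₁ x₂ v → Σ (Vertex B) λ u → adj B v u ≡ true × ¬ InPair x₁ x₂ u) →
  (∀ v → ¬ InPair x₁ x₂ v → Σ (Vertex B) λ u →
     (adj B v u ≡ true × ¬ InPair x₁ x₂ u) ⊎ (adj B v u ≡ false × InPair x₁ x₂ u)) →
  Certificate P B (definedColouring B pairᶠ e x₁ x₂)
pair-certificate P B e x₁ x₂ (ēe , ee , eē) inside outside v = certify ((v ≟ᶠ x₁) ⊎-dec (v ≟ᶠ x₂))
  where
  colour = definedColouring B pairᶠ e x₁ x₂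
  colour-in = colour-inside B pairᶠ e x₁ x₂
  colour-out = colour-outside B pairᶠ e x₁ x₂
  certify : Dec (InPair x₁ x₂ v) → CertifiedAt P B colour v
  certify (yes v∈) =
    let (u , vu , u∉) = inside v v∈
    in  u , (λ v≡u → u∉ (subst (InPair x₁ x₂) v≡u v∈)) ,
        from (allowed-≡ P vu (colour-in v∈) (colour-out u∉)) ēe
  certify (no v∉) with outside v v∉
  ... | u , inj₁ (vu , u∉) = u , edge⇒≢ B vu , from (allowed-≡ P vu (colour-out v∉) (colour-out u∉)) ee
  ... | u , inj₂ (vu , u∈) =
    u , (λ v≡u → v∉ (subst (InPair x₁ x₂) (sym v≡u) u∈)) ,
    from (allowed-≡ P vu (colour-out v∉) (colour-in u∈)) eē

nonIsolated-certificate : ∀ P B e → A⊕ P (flip e) (flip e) ≡ true → A⊖ P e (flip e) ≡ true → HasEdge B →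
  ∀ x₁ x₂ → Certificate P B (definedColouring B nonIsolatedᶠ e x₁ x₂)
nonIsolated-certificate P B e ēē eē (p , p-nonIso) x₁ x₂ v = certify (neighbour? (adj B) v)
  where
  colour = definedColouring B nonIsolatedᶠ e x₁ x₂
  inside = colour-inside B nonIsolatedᶠ e x₁ x₂
  outside = colour-outside B nonIsolatedᶠ e x₁ x₂
  certify : Dec (NonIsolated B v) → CertifiedAt P B colour v
  certify (yes (u , vu)) =
    u , edge⇒≢ B vu , from (allowed-≡ P vu (inside (u , vu)) (inside (v , edge-sym B vu))) ēē
  certify (no v-iso) =
    p , (λ { refl → v-iso p-nonIso }) ,
    from (allowed-≡ P (¬-not λ vp → v-iso (p , vp)) (outside v-iso) (inside p-nonIso)) eē

Pendant : (B : BasicGraph) → Vertex B → Vertex B → Set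
Pendant B s x = ∀ u → adj B s u ≡ true → u ≡ x

NotPendantNeighbour : (B : BasicGraph) → Vertex B → Vertex B → Set
NotPendantNeighbour B x s = adj B x s ≡ true → Σ (Vertex B) λ u → adj B s u ≡ true × u ≢ x

NoPendantNeighbour : (B : BasicGraph) → Vertex B → Set
NoPendantNeighbour B x = ∀ s → NotPendantNeighbour B x s

notPendantNeighbour? : ∀ B x s → Dec (NotPendantNeighbour B x s)
notPendantNeighbour? B x s = (adj B x s ≟ᵇ true) →-dec any? λ u → (adj B s u ≟ᵇ true) ×-dec ¬? (u ≟ᶠ x)

¬notPendantNeighbour : ∀ B {x s} → ¬ NotPendantNeighbour B x s → adj B x s ≡ true × Pendant B s x
¬notPendantNeighbour B {x} {s} ¬np = xs , pendant
  where
  xs : adj B x s ≡ true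
  xs with adj B x s
  ... | true  = refl
  ... | false = contradiction (λ ()) ¬np
  pendant : Pendant B s x
  pendant u su with u ≟ᶠ x
  ... | yes u≡x = u≡x
  ... | no u≢x  = contradiction (λ _ → u , su , u≢x) ¬np

noPendantNeighbour⊎pendant : ∀ B x →
  NoPendantNeighbour B x ⊎ Σ (Vertex B) λ s → adj B x s ≡ true × Pendant B s x
noPendantNeighbour⊎pendant B x with all? (notPendantNeighbour? B x)
... | yes np = inj₁ np
... | no ¬np =
  let (s , ¬nps) = ¬∀⟶∃¬ _ _ (notPendantNeighbour? B x) ¬np in inj₂ (s , ¬notPendantNeighbour B ¬nps)

-- In the second case y and s form a connected component.
noPendantNeighbour⊎isolatedEdge : ∀ B {y y′} → adj B y y′ ≡ true →
  (Σ (Vertex B) λ x → NonIsolated B x × NoPendantNeighbour B x) ⊎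
  (Σ (Vertex B) λ s → adj B y s ≡ true × Pendant B s y × Pendant B y s)
noPendantNeighbour⊎isolatedEdge B {y} {y′} yy′ with noPendantNeighbour⊎pendant B y
... | inj₁ np = inj₁ (y , (y′ , yy′) , np)
... | inj₂ (s , ys , s-pendant) with noPendantNeighbour⊎pendant B s
...   | inj₁ np = inj₁ (s , (y , edge-sym B ys) , np)
...   | inj₂ (s′ , ss′ , s′-pendant) =
  inj₂ (s , ys , s-pendant , subst (λ t → Pendant B t s) (s-pendant s′ ss′) s′-pendant)

single-certificate : ∀ P B e {x nb} → adj B x nb ≡ true → NoPendantNeighbour B x → PairPattern P e →
                     Certificate P B (definedColouring B pairᶠ e x x)
single-certificate P B e {x} {nb} xnb np pairPattern =
  pair-certificate P B e x x pairPattern inside outside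
  where
  inside : ∀ v → InPair x x v → Σ (Vertex B) λ u → adj B v u ≡ true × ¬ InPair x x u
  inside v v∈ with reduce v∈
  ... | refl = nb , xnb , λ nb∈ → edge⇒≢ B xnb (sym (reduce nb∈))
  outside : ∀ v → ¬ InPair x x v → Σ (Vertex B) λ u →
            (adj B v u ≡ true × ¬ InPair x x u) ⊎ (adj B v u ≡ false × InPair x x u)
  outside v _ with adj B v x in vx
  ... | true  = let (u , vu , u≢x) = np v (edge-sym B vx) in u , inj₁ (vu , λ u∈ → u≢x (reduce u∈))
  ... | false = x , inj₂ (vx , inj₁ refl)

noIsolatedᶠ : Formula 0
noIsolatedᶠ = ∀ᶠ (∃ᶠ E⟨ suc zero , zero ⟩)

hasEdgeᶠ : Formula 0
hasEdgeᶠ = ∃ᶠ (∃ᶠ E⟨ suc zero , zero ⟩)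

NonEmpty : (Color → Color → Bool) → Set
NonEmpty A = Σ Color λ a → Σ Color λ b → A a b ≡ true

nonEmpty? : ∀ A → Dec (NonEmpty A)
nonEmpty? A = ∃ᶜ? λ a → ∃ᶜ? λ b → A a b ≟ᵇ true

someColour : (Color → Formula 0) → Formula 0
someColour f = f black ∨ᶠ f white

someColour-intro : ∀ B f c → B ⊨ f c → B ⊨ someColour f
someColour-intro B f black h = inj₁ h
someColour-intro B f white h = inj₂ h

someColour-elim : ∀ B f → B ⊨ someColour f → Σ Color λ c → B ⊨ f c
someColour-elim B f (inj₁ h) = black , h
someColour-elim B f (inj₂ h) = white , h

Ψ : PatternGraph → Formula 0
Ψ P = (when (cyclic? (A⊕ P)) noIsolatedᶠ ∨ᶠ when (twoCycle? (A⊕ P) ×-dec nonEmpty? (A⊖ P)) hasEdgeᶠ)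
      ∨ᶠ (someColour (template P nonIsolatedᶠ) ∨ᶠ someColour (template P pairᶠ))

Ψ-sound : ∀ P B → B ⊨ Ψ P → InSaturation P B
Ψ-sound P B (inj₁ (inj₁ h)) =
  let (cyclic , noIso) = when-elim B (cyclic? (A⊕ P)) noIsolatedᶠ h
  in  cyclic⇒noIsolated⇒saturated P B cyclic noIso
Ψ-sound P B (inj₁ (inj₂ h)) =
  let ((twoCycle , _ , _ , dd′) , edge) =
        when-elim B (twoCycle? (A⊕ P) ×-dec nonEmpty? (A⊖ P)) hasEdgeᶠ h
  in  twoCycle⇒edge⇒saturated P B twoCycle dd′ edge
Ψ-sound P B (inj₂ (inj₁ h)) =
  let (c , t) = someColour-elim B (template P nonIsolatedᶠ) h in template-sound P B nonIsolatedᶠ c t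
Ψ-sound P B (inj₂ (inj₂ h)) =
  let (c , t) = someColour-elim B (template P pairᶠ) h in template-sound P B pairᶠ c t

Ψ-noIsolated : ∀ P B → Cyclic (A⊕ P) → NoIsolatedVertex B → B ⊨ Ψ P
Ψ-noIsolated P B cyclic noIso = inj₁ (inj₁ (when-intro B (cyclic? (A⊕ P)) noIsolatedᶠ cyclic noIso))

module IsolatedVertex (P : PatternGraph) (B : BasicGraph) (sat : InSaturation P B)
                      {z} (z-isolated : Isolated B z) (acyclic⊖ : ¬ Cyclic (A⊖ P)) where
  c : Colouring B
  c = proj₁ sat

  cert : Certificate P B c
  cert = saturated⇒certificate P B sat

  w : Vertex B → Vertex B
  w x = proj₁ (cert x)

  w-≢ : ∀ x → x ≢ w x
  w-≢ x = proj₁ (proj₂ (cert x))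

  w-allowed : ∀ {x s a b} → adj B x (w x) ≡ s → c x ≡ a → c (w x) ≡ b → allowed P s a b ≡ true
  w-allowed {x} p q r = to (allowed-≡ P p q r) (proj₂ (proj₂ (cert x)))

  e ē : Color
  e = c z
  ē = flip e

  cwz : c (w z) ≡ ē
  cwz = ≢⇒≡flip λ e≡cwz → let ee = w-allowed (z-isolated (w z)) refl (sym e≡cwz) in
                           acyclic⊖ (path⇒cyclic (A⊖ P) ee ee)

  eē : A⊖ P e ē ≡ true
  eē = w-allowed (z-isolated (w z)) refl cwz

  hasEdge : HasEdge B
  hasEdge with adj B (w z) (w (w z)) in eq
  ... | true  = w z , w (w z) , eq
  ... | false = contradiction (path⇒cyclic (A⊖ P) eē (w-allowed eq cwz refl)) acyclic⊖

  module OneLoop (cyclic⊕ : Cyclic (A⊕ P)) (¬twoCycle : ¬ TwoCycle (A⊕ P)) (ēē : A⊕ P ē ē ≡ false) where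
    from-ē : ∀ s d → allowed P s ē d ≡ true → s ≡ true × d ≡ e
    from-ē false d ēd = contradiction (path⇒cyclic (A⊖ P) eē ēd) acyclic⊖
    from-ē true  d ēd with ≡⊎≡flip e d
    ... | inj₁ refl = refl , refl
    ... | inj₂ refl = contradiction (trans (sym ēd) ēē) λ ()

    toward-e : ∀ v → c v ≡ ē → adj B v (w v) ≡ true × c (w v) ≡ e
    toward-e v cv = from-ē _ _ (w-allowed refl cv refl)

    y : Vertex B
    y = w z

    y-edge : adj B y (w y) ≡ true × c (w y) ≡ e
    y-edge = toward-e y cwz

    pairPattern : PairPattern P e
    pairPattern = w-allowed (proj₁ y-edge) cwz (proj₂ y-edge) ,
                  loop-at-other (A⊕ P) e cyclic⊕ ¬twoCycle ēē , eē

    -- The pair is y and the witness q of s, a non-neighbour of s of colour ē.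
    module IsolatedEdge {s} (ys : adj B y s ≡ true)
                        (s-pendant : Pendant B s y) (y-pendant : Pendant B y s) where
      q : Vertex B
      q = w s

      cs : c s ≡ e
      cs = subst (λ t → c t ≡ e) (y-pendant (w y) (proj₁ y-edge)) (proj₂ y-edge)

      s≁q : adj B s q ≡ false
      s≁q = ¬-not λ sq → ¬twoCycle (twoCycle-intro (A⊕ P) e
              (w-allowed sq cs (trans (cong c (s-pendant q sq)) cwz)) (proj₁ pairPattern))

      cq : c q ≡ ē
      cq = ≢⇒≡flip λ e≡cq → let ee = w-allowed s≁q cs (sym e≡cq) in acyclic⊖ (path⇒cyclic (A⊖ P) ee ee)

      q-edge : adj B q (w q) ≡ true × c (w q) ≡ e
      q-edge = toward-e q cq

      wq≢y : w q ≢ y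
      wq≢y wq≡y = w-≢ s (sym (y-pendant q (edge-sym B (subst (λ t → adj B q t ≡ true) wq≡y (proj₁ q-edge)))))

      certificate : Certificate P B (definedColouring B pairᶠ e y q)
      certificate = pair-certificate P B e y q pairPattern inside outside
        where
        inside : ∀ v → InPair y q v → Σ (Vertex B) λ u → adj B v u ≡ true × ¬ InPair y q u
        inside v (inj₁ refl) = s , ys , [ (λ s≡y → edge⇒≢ B ys (sym s≡y)) , (λ s≡q → w-≢ s s≡q) ]
        inside v (inj₂ refl) = w q , proj₁ q-edge , [ wq≢y , (λ wq≡q → w-≢ q (sym wq≡q)) ]
        outside : ∀ v → ¬ InPair y q v → Σ (Vertex B) λ u →
                  (adj B v u ≡ true × ¬ InPair y q u) ⊎ (adj B v u ≡ false × InPair y q u)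
        outside v _ with v ≟ᶠ s
        ... | yes refl = q , inj₂ (s≁q , inj₂ refl)
        ... | no v≢s   = y , inj₂ (¬-not (λ vy → v≢s (y-pendant v (edge-sym B vy))) , inj₁ refl)

    pair : Σ (Vertex B) λ x₁ → Σ (Vertex B) λ x₂ → Certificate P B (definedColouring B pairᶠ e x₁ x₂)
    pair with noPendantNeighbour⊎isolatedEdge B (proj₁ y-edge)
    ... | inj₁ (x , (_ , xnb) , np) = x , x , single-certificate P B e xnb np pairPattern
    ... | inj₂ (s , ys , s-pendant , y-pendant) =
      y , w s , IsolatedEdge.certificate ys s-pendant y-pendant

  ⊨Ψ : Cyclic (A⊕ P) → B ⊨ Ψ P
  ⊨Ψ cyclic⊕ = byPattern (twoCycle? (A⊕ P)) (A⊕ P ē ē) refl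
    where
    byPattern : Dec (TwoCycle (A⊕ P)) → ∀ b → A⊕ P ē ē ≡ b → B ⊨ Ψ P
    byPattern (yes twoCycle) _ _ = inj₁ (inj₂
      (when-intro B (twoCycle? (A⊕ P) ×-dec nonEmpty? (A⊖ P)) hasEdgeᶠ (twoCycle , e , ē , eē) hasEdge))
    byPattern (no _) true ēē = inj₂ (inj₁ (someColour-intro B (template P nonIsolatedᶠ) e
      (template-complete P B nonIsolatedᶠ e z z (nonIsolated-certificate P B e ēē eē hasEdge z z))))
    byPattern (no ¬twoCycle) false ēē =
      let (x₁ , x₂ , certificate) = OneLoop.pair cyclic⊕ ¬twoCycle ēē
      in  inj₂ (inj₂ (someColour-intro B (template P pairᶠ) e
            (template-complete P B pairᶠ e x₁ x₂ certificate)))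

Ψ-complete : ∀ P B → Cyclic (A⊕ P) → InSaturation P B →
             B ⊨ Ψ P ⊎ (Cyclic (A⊖ P) × Σ (Vertex B) (Isolated B))
Ψ-complete P B cyclic⊕ sat with noIsolatedVertex⊎isolated B | cyclic? (A⊖ P)
... | inj₁ noIso         | _            = inj₁ (Ψ-noIsolated P B cyclic⊕ noIso)
... | inj₂ (z , z-iso)   | yes cyclic⊖ = inj₂ (cyclic⊖ , z , z-iso)
... | inj₂ (z , z-iso)   | no acyclic⊖ = inj₁ (IsolatedVertex.⊨Ψ P B sat z-iso acyclic⊖ cyclic⊕)

Φ : PatternGraph → Formula 0
Φ P = Ψ P ∨ᶠ complementᶠ (Ψ (swap P))

Φ-sound : ∀ P B → B ⊨ Φ P → InSaturation P B
Φ-sound P B (inj₁ ψ)  = Ψ-sound P B ψ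
Φ-sound P B (inj₂ ψᶜ) = saturated-uncomplement P B
  (Ψ-sound (swap P) (complement B) (to (⊨-complementᶠ B (Ψ (swap P)) emptyEnv) ψᶜ))

Φ-complement : ∀ P B → complement B ⊨ Ψ (swap P) → B ⊨ Φ P
Φ-complement P B ψᶜ = inj₂ (from (⊨-complementᶠ B (Ψ (swap P)) emptyEnv) ψᶜ)

Φ-complete : ∀ P B → Cyclic (A⊕ P) ⊎ Cyclic (A⊖ P) → InSaturation P B → B ⊨ Φ P
Φ-complete P B (inj₁ cyclic⊕) sat with Ψ-complete P B cyclic⊕ sat
... | inj₁ ψ = inj₁ ψ
... | inj₂ (cyclic⊖ , z , z-iso) = Φ-complement P B (Ψ-noIsolated (swap P) (complement B) cyclic⊖ noIsoᶜ)
  where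
  noIsoᶜ = universal⇒noIsolatedVertex (complement B) (isolated⇒universal-complement B z-iso)
                                      (saturated⇒other P B sat z)
Φ-complete P B (inj₂ cyclic⊖) sat with Ψ-complete (swap P) (complement B) cyclic⊖ (saturated-complement P B sat)
... | inj₁ ψᶜ = Φ-complement P B ψᶜ
... | inj₂ (cyclic⊕ , z , z-iso) = inj₁ (Ψ-noIsolated P B cyclic⊕ noIso)
  where
  noIso = universal⇒noIsolatedVertex B (isolated-complement⇒universal B z-iso) (saturated⇒other P B sat z)

lemma20 : (P : PatternGraph) →
          HasCycle (A⊕ P) ⊎ HasCycle (A⊖ P) →
          InFO (InSaturation P)
lemma20 P hasCycle = Φ P , λ B → mk⇔ (Φ-sound P B)
  (Φ-complete P B (⊎-map (hasCycle⇒cyclic (A⊕ P)) (hasCycle⇒cyclic (A⊖ P)) hasCycle))
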